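{- If $m,n\ge 2$, then $\mu^{ - }(P_m\,\square\, P_n)=3$.
   Context: $P_k$ is the path on $k$ vertices and $\square$ denotes the Cartesian product of graphs: $V(G\square H)=V(G)\times V(H)$, with $(g,h)(g',h')$ an edge iff ($g=g'$ and $hh'\in E(H)$) or ($gg'\in E(G)$ and $h=h'$). For $X\subseteq V(G)$, two vertices $a,b$ are $X$-visible if there is a shortest $a,b$-path $P$ in $G$ with $V(P)\cap X\subseteq\{a,b\}$. A set $X$ is a mutual-visibility set if every two vertices of $X$ are $X$-visible; it is maximal if no proper superset is a mutual-visibility set. $\mu^{ - }(G)$ is the minimum cardinality of a maximal mutual-visibility set of $G$. -}

module Defs where

open import Level using (0ℓ)
open import Data.Nat using (ℕ; zero; suc; _<_; _≤_)
open import Data.Fin using (Fin; toℕ)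
open import Data.Product using (Σ; ∃; _×_; _,_)
open import Data.Sum using (_⊎_)
open import Data.List using (List; length)
open import Data.List.Membership.Propositional using (_∈_)
open import Data.List.Relation.Unary.Unique.Propositional using (Unique)
open import Relation.Nullary using (¬_)
open import Relation.Binary.PropositionalEquality using (_≡_)

record Graph : Set₁ where
  field
    V   : Set
    Adj : V → V → Set
open Graph public

P : ℕ → Graph
P k = record { V = Fin k ; Adj = λ i j → (toℕ j ≡ suc (toℕ i)) ⊎ (toℕ i ≡ suc (toℕ j)) }

_□_ : Graph → Graph → Graph
G □ H = record
  { V   = V G × V H
  ; Adj = λ { (g , h) (g' , h') → ((g ≡ g') × Adj H h h') ⊎ (Adj G g g' × (h ≡ h')) } }

data Walk (G : Graph) : V G → V G → ℕ → Set where
  here : ∀ a → Walk G a a zero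
  step : ∀ {a b c k} → Adj G a b → Walk G b c k → Walk G a c (suc k)

data OnWalk (G : Graph) (v : V G) : ∀ {a b k} → Walk G a b k → Set where
  on-here : OnWalk G v (here v)
  on-head : ∀ {b c k} (e : Adj G v b) (w : Walk G b c k) → OnWalk G v (step e w)
  on-tail : ∀ {a b c k} (e : Adj G a b) {w : Walk G b c k} → OnWalk G v w → OnWalk G v (step e w)

Shortest : (G : Graph) → ∀ {a b k} → Walk G a b k → Set
Shortest G {a} {b} {k} w = ∀ j → j < k → ¬ Walk G a b j

Visible : (G : Graph) → (V G → Set) → V G → V G → Set
Visible G X a b =
  Σ ℕ λ k → Σ (Walk G a b k) λ w → Shortest G w ×
    (∀ v → OnWalk G v w → X v → (v ≡ a) ⊎ (v ≡ b))

IsMutualVisibility : (G : Graph) → (V G → Set) → Set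
IsMutualVisibility G X = ∀ a b → X a → X b → Visible G X a b

IsMaximalMV : (G : Graph) → (V G → Set) → Set₁
IsMaximalMV G X = IsMutualVisibility G X ×
  ((Y : V G → Set) → (∀ v → X v → Y v) → IsMutualVisibility G Y → ∀ v → Y v → X v)

-- Finite vertex sets are given as duplicate-free lists; cardinality = length.
ListSet : (G : Graph) → List (V G) → V G → Set
ListSet G xs v = v ∈ xs

μ⁻≡ : Graph → ℕ → Set₁
μ⁻≡ G r =
  (Σ (List (V G)) λ xs → Unique xs × length xs ≡ r × IsMaximalMV G (ListSet G xs))
  × (∀ (xs : List (V G)) → Unique xs → IsMaximalMV G (ListSet G xs) → r ≤ length xs)

-- The grid distance of (x₁ , x₂) and (y₁ , y₂) is |x₁ - y₁| + |x₂ - y₂|, realised by the two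
-- L-shaped walks turning at (y₁ , x₂) and at (x₁ , y₂).  Hence x and y see each other in Y as
-- soon as every other point of Y lies off both lines of one of these L-walks, and "generic"
-- triangles are mutual-visibility sets.
-- The corner (0,0) with its two neighbours is maximal: every shortest path leaving the corner
-- passes through one of them.  Conversely any two distinct vertices extend by a third to a
-- mutual-visibility triangle, so no set of at most two vertices is maximal.
module Submission where

open import Defs
open import Data.Nat using (ℕ; zero; suc; _+_; _≤_; _≥_; z≤n; s≤s; ∣_-_∣)
open import Data.Nat.Properties
  using (∣-∣-triangle; ∣-∣-comm; ∣n-n∣≡0; <⇒≱; n<1+n; ≤-trans; ≤-reflexive; +-monoʳ-≤; +-monoˡ-≤; +-suc; +-comm)
open import Data.Fin using (Fin; toℕ; punchIn; _≟_)
open import Data.Fin.Properties using (punchInᵢ≢i)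
open import Data.Product using (Σ; _×_; _,_; proj₁; proj₂)
open import Data.Sum using (_⊎_; inj₁; inj₂; [_,_]; swap)
open import Data.Empty using (⊥-elim)
open import Data.List using (List; []; _∷_; length)
open import Data.List.Membership.Propositional using (_∈_; _∉_)
open import Data.List.Membership.Propositional.Properties using (∈-++⁺ˡ)
open import Data.List.Relation.Unary.Any using (here; there)
open import Data.List.Relation.Unary.All using (All; []; _∷_; lookup)
open import Data.List.Relation.Unary.AllPairs using ([]; _∷_)
open import Data.List.Relation.Unary.Unique.Propositional using (Unique)
open import Function using (_∘_; id)
open import Relation.Nullary using (¬_; yes; no)
open import Relation.Binary.PropositionalEquality using (_≡_; _≢_; refl; sym; trans; cong; cong₂)

module _ {G : Graph} where

  _++ʷ_ : ∀ {a b c s t} → Walk G a b s → Walk G b c t → Walk G a c (s + t)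
  here _   ++ʷ w′ = w′
  step e w ++ʷ w′ = step e (w ++ʷ w′)

  on-++ʷ : ∀ {a b c s t v} (w : Walk G a b s) (w′ : Walk G b c t) →
           OnWalk G v (w ++ʷ w′) → OnWalk G v w ⊎ OnWalk G v w′
  on-++ʷ (here _)   w′ p                  = inj₂ p
  on-++ʷ (step e w) w′ (on-head .e ._)    = inj₁ (on-head e w)
  on-++ʷ (step e w) w′ (on-tail .e p) with on-++ʷ w w′ p
  ... | inj₁ q = inj₁ (on-tail e q)
  ... | inj₂ q = inj₂ q

  snocʷ : ∀ {a b c k} → Walk G a b k → Adj G b c → Walk G a c (suc k)
  snocʷ (here _)   e′ = step e′ (here _)
  snocʷ (step e w) e′ = step e (snocʷ w e′)

  start-on : ∀ {a b k} (w : Walk G a b k) → OnWalk G a w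
  start-on (here a)   = on-here
  start-on (step e w) = on-head e w

  visible-refl : ∀ {Y a} → Visible G Y a a
  visible-refl = 0 , here _ , (λ _ ()) , λ { _ on-here _ → inj₁ refl }

  visible-along : ∀ {Y Q : V G → Set} {x y k} (w : Walk G x y k) → Shortest G w →
                  (∀ v → OnWalk G v w → Q v) → (∀ v → Y v → v ≡ x ⊎ v ≡ y ⊎ ¬ Q v) →
                  Visible G Y x y
  visible-along {Y} {Q} {x} {y} w shortest on⇒Q cover = _ , w , shortest , clear
    where
    clear : ∀ v → OnWalk G v w → Y v → v ≡ x ⊎ v ≡ y
    clear v p Yv with cover v Yv
    ... | inj₁ v≡x        = inj₁ v≡x
    ... | inj₂ (inj₁ v≡y) = inj₂ v≡y
    ... | inj₂ (inj₂ ¬Qv) = ⊥-elim (¬Qv (on⇒Q v p))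

  -- The vertex c after a lies in Y, so it is an endpoint; c ≡ a would leave a shorter walk.
  enclosed-sees-neighbours : ∀ {Y a v} → (∀ c → Adj G a c → Y c) → Visible G Y a v → v ≡ a ⊎ Adj G a v
  enclosed-sees-neighbours enclosed (zero , here _ , _) = inj₁ refl
  enclosed-sees-neighbours enclosed (suc k , step {b = c} e w , shortest , clear)
    with clear c (on-tail e (start-on w)) (enclosed c e)
  ... | inj₁ refl = ⊥-elim (shortest k (n<1+n k) w)
  ... | inj₂ refl = inj₂ e

module _ {G H : Graph} where

  □-walkˡ : ∀ {g g′ t} → Walk G g g′ t → (h : V H) → Walk (G □ H) (g , h) (g′ , h) t
  □-walkˡ (here g)   h = here (g , h)
  □-walkˡ (step e w) h = step (inj₂ (e , refl)) (□-walkˡ w h)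

  □-walkʳ : ∀ {h h′ t} (g : V G) → Walk H h h′ t → Walk (G □ H) (g , h) (g , h′) t
  □-walkʳ g (here h)   = here (g , h)
  □-walkʳ g (step e w) = step (inj₁ (refl , e)) (□-walkʳ g w)

  on-□-walkˡ : ∀ {g g′ t v} (w : Walk G g g′ t) (h : V H) → OnWalk (G □ H) v (□-walkˡ w h) → proj₂ v ≡ h
  on-□-walkˡ (here _)   h on-here       = refl
  on-□-walkˡ (step e w) h (on-head _ _) = refl
  on-□-walkˡ (step e w) h (on-tail _ p) = on-□-walkˡ w h p

  on-□-walkʳ : ∀ {h h′ t v} (g : V G) (w : Walk H h h′ t) → OnWalk (G □ H) v (□-walkʳ g w) → proj₁ v ≡ g
  on-□-walkʳ g (here _)   on-here       = refl
  on-□-walkʳ g (step e w) (on-head _ _) = refl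
  on-□-walkʳ g (step e w) (on-tail _ p) = on-□-walkʳ g w p

P-walk-suc : ∀ {k i j t} → Walk (P k) i j t → Walk (P (suc k)) (Fin.suc i) (Fin.suc j) t
P-walk-suc (here i)          = here (Fin.suc i)
P-walk-suc (step (inj₁ e) w) = step (inj₁ (cong suc e)) (P-walk-suc w)
P-walk-suc (step (inj₂ e) w) = step (inj₂ (cong suc e)) (P-walk-suc w)

P-walk-to-zero : ∀ {k} (i : Fin (suc k)) → Walk (P (suc k)) i Fin.zero (toℕ i)
P-walk-to-zero Fin.zero             = here Fin.zero
P-walk-to-zero {suc _} (Fin.suc i) = snocʷ (P-walk-suc (P-walk-to-zero i)) (inj₂ refl)

P-walk : ∀ {k} (i j : Fin k) → Walk (P k) i j ∣ toℕ i - toℕ j ∣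
P-walk Fin.zero    Fin.zero    = here Fin.zero
P-walk (Fin.suc i) (Fin.suc j) = P-walk-suc (P-walk i j)
P-walk (Fin.suc i) Fin.zero    = P-walk-to-zero (Fin.suc i)
P-walk {suc (suc _)} Fin.zero (Fin.suc j) = step (inj₁ refl) (P-walk-suc (P-walk Fin.zero j))

∣n-1+n∣≡1 : ∀ n → ∣ n - suc n ∣ ≡ 1
∣n-1+n∣≡1 zero    = refl
∣n-1+n∣≡1 (suc n) = ∣n-1+n∣≡1 n

∣-∣-step : ∀ {x y} → y ≡ suc x ⊎ x ≡ suc y → ∀ z → ∣ x - z ∣ ≤ suc ∣ y - z ∣
∣-∣-step {x} (inj₁ refl) z =
  ≤-trans (∣-∣-triangle x (suc x) z) (≤-reflexive (cong (_+ ∣ suc x - z ∣) (∣n-1+n∣≡1 x)))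
∣-∣-step {y = y} (inj₂ refl) z =
  ≤-trans (∣-∣-triangle (suc y) y z)
          (≤-reflexive (cong (_+ ∣ y - z ∣) (trans (∣-∣-comm (suc y) y) (∣n-1+n∣≡1 y))))

module Grid (m n : ℕ) where

  G : Graph
  G = P m □ P n

  dist : V G → V G → ℕ
  dist (x₁ , x₂) (y₁ , y₂) = ∣ toℕ x₁ - toℕ y₁ ∣ + ∣ toℕ x₂ - toℕ y₂ ∣

  dist-adj : ∀ {a b} → Adj G a b → ∀ c → dist a c ≤ suc (dist b c)
  dist-adj {a₁ , _} {_ , b₂} (inj₁ (refl , e)) (c₁ , c₂) =
    ≤-trans (+-monoʳ-≤ ∣ toℕ a₁ - toℕ c₁ ∣ (∣-∣-step e (toℕ c₂)))
            (≤-reflexive (+-suc ∣ toℕ a₁ - toℕ c₁ ∣ ∣ toℕ b₂ - toℕ c₂ ∣))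
  dist-adj {_ , a₂} (inj₂ (e , refl)) (c₁ , c₂) = +-monoˡ-≤ ∣ toℕ a₂ - toℕ c₂ ∣ (∣-∣-step e (toℕ c₁))

  dist≤length : ∀ {a b k} → Walk G a b k → dist a b ≤ k
  dist≤length (here (a₁ , a₂)) = ≤-reflexive (cong₂ _+_ (∣n-n∣≡0 (toℕ a₁)) (∣n-n∣≡0 (toℕ a₂)))
  dist≤length (step e w) = ≤-trans (dist-adj e _) (s≤s (dist≤length w))

  length≡dist⇒shortest : ∀ {a b k} (w : Walk G a b k) → k ≡ dist a b → Shortest G w
  length≡dist⇒shortest w refl j j<k w′ = <⇒≱ j<k (dist≤length w′)

  OnLines OffLines : Fin m → Fin n → V G → Set
  OnLines  i j z = proj₁ z ≡ i ⊎ proj₂ z ≡ j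
  OffLines i j z = proj₁ z ≢ i × proj₂ z ≢ j

  hv-walk : ∀ x y → Walk G x y (dist x y)
  hv-walk (x₁ , x₂) (y₁ , y₂) = □-walkˡ (P-walk x₁ y₁) x₂ ++ʷ □-walkʳ y₁ (P-walk x₂ y₂)

  vh-walk : ∀ x y → Walk G x y (∣ toℕ (proj₂ x) - toℕ (proj₂ y) ∣ + ∣ toℕ (proj₁ x) - toℕ (proj₁ y) ∣)
  vh-walk (x₁ , x₂) (y₁ , y₂) = □-walkʳ x₁ (P-walk x₂ y₂) ++ʷ □-walkˡ (P-walk x₁ y₁) y₂

  on-hv-walk : ∀ x y v → OnWalk G v (hv-walk x y) → OnLines (proj₁ y) (proj₂ x) v
  on-hv-walk (x₁ , x₂) (y₁ , y₂) v p with on-++ʷ (□-walkˡ (P-walk x₁ y₁) x₂) _ p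
  ... | inj₁ q = inj₂ (on-□-walkˡ (P-walk x₁ y₁) x₂ q)
  ... | inj₂ q = inj₁ (on-□-walkʳ y₁ (P-walk x₂ y₂) q)

  on-vh-walk : ∀ x y v → OnWalk G v (vh-walk x y) → OnLines (proj₁ x) (proj₂ y) v
  on-vh-walk (x₁ , x₂) (y₁ , y₂) v p with on-++ʷ (□-walkʳ x₁ (P-walk x₂ y₂)) _ p
  ... | inj₁ q = inj₁ (on-□-walkʳ x₁ (P-walk x₂ y₂) q)
  ... | inj₂ q = inj₂ (on-□-walkˡ (P-walk x₁ y₁) y₂ q)

  Avoids : V G → V G → V G → Set
  Avoids x y z = OffLines (proj₁ y) (proj₂ x) z ⊎ OffLines (proj₁ x) (proj₂ y) z

  avoids-sym : ∀ {x y z} → Avoids x y z → Avoids y x z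
  avoids-sym = swap

  Among : V G → V G → V G → V G → Set
  Among x y z v = v ≡ x ⊎ v ≡ y ⊎ v ≡ z

  off-lines-cover : ∀ {x y z i j xs} → OffLines i j z → All (Among x y z) xs →
                    ∀ v → v ∈ xs → v ≡ x ⊎ v ≡ y ⊎ ¬ OnLines i j v
  off-lines-cover (≢i , ≢j) among v v∈xs with lookup among v∈xs
  ... | inj₁ v≡x         = inj₁ v≡x
  ... | inj₂ (inj₁ v≡y)  = inj₂ (inj₁ v≡y)
  ... | inj₂ (inj₂ refl) = inj₂ (inj₂ [ ≢i , ≢j ])

  visible-in-triangle : ∀ {x y z xs} → Avoids x y z → All (Among x y z) xs → Visible G (ListSet G xs) x y
  visible-in-triangle {x} {y} (inj₁ off) among =
    visible-along {Q = OnLines (proj₁ y) (proj₂ x)} (hv-walk x y) (length≡dist⇒shortest (hv-walk x y) refl)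
      (on-hv-walk x y) (off-lines-cover off among)
  visible-in-triangle {x} {y} (inj₂ off) among =
    visible-along {Q = OnLines (proj₁ x) (proj₂ y)} (vh-walk x y)
      (length≡dist⇒shortest (vh-walk x y) (+-comm ∣ toℕ (proj₂ x) - toℕ (proj₂ y) ∣ _))
      (on-vh-walk x y) (off-lines-cover off among)

  triangle-isMutualVisibility : ∀ {a b c} → Avoids a b c → Avoids a c b → Avoids b c a →
                               IsMutualVisibility G (ListSet G (a ∷ b ∷ c ∷ []))
  triangle-isMutualVisibility ab ac bc = λ where
    _ _ (here refl)                 (here refl)                 → visible-refl
    _ _ (there (here refl))         (there (here refl))         → visible-refl
    _ _ (there (there (here refl))) (there (there (here refl))) → visible-refl
    _ _ (here refl) (there (here refl)) →
      visible-in-triangle ab (inj₁ refl ∷ inj₂ (inj₁ refl) ∷ inj₂ (inj₂ refl) ∷ [])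
    _ _ (there (here refl)) (here refl) →
      visible-in-triangle (avoids-sym ab) (inj₂ (inj₁ refl) ∷ inj₁ refl ∷ inj₂ (inj₂ refl) ∷ [])
    _ _ (here refl) (there (there (here refl))) →
      visible-in-triangle ac (inj₁ refl ∷ inj₂ (inj₂ refl) ∷ inj₂ (inj₁ refl) ∷ [])
    _ _ (there (there (here refl))) (here refl) →
      visible-in-triangle (avoids-sym ac) (inj₂ (inj₁ refl) ∷ inj₂ (inj₂ refl) ∷ inj₁ refl ∷ [])
    _ _ (there (here refl)) (there (there (here refl))) →
      visible-in-triangle bc (inj₂ (inj₂ refl) ∷ inj₁ refl ∷ inj₂ (inj₁ refl) ∷ [])
    _ _ (there (there (here refl))) (there (here refl)) →
      visible-in-triangle (avoids-sym bc) (inj₂ (inj₂ refl) ∷ inj₂ (inj₁ refl) ∷ inj₁ refl ∷ [])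
    _ _ (there (there (there ()))) _
    _ _ _ (there (there (there ())))

module NontrivialGrid (m n : ℕ) where
  open Grid (suc (suc m)) (suc (suc n))

  corner p q : V G
  corner = Fin.zero , Fin.zero
  p      = Fin.zero , Fin.suc Fin.zero
  q      = Fin.suc Fin.zero , Fin.zero

  corner-triangle : List (V G)
  corner-triangle = corner ∷ p ∷ q ∷ []

  corner-neighbours : ∀ {c} → Adj G corner c → c ≡ p ⊎ c ≡ q
  corner-neighbours {_ , Fin.suc Fin.zero} (inj₁ (refl , inj₁ refl)) = inj₁ refl
  corner-neighbours {Fin.suc Fin.zero , _} (inj₂ (inj₁ refl , refl)) = inj₂ refl
  corner-neighbours {_ , Fin.zero}          (inj₁ (refl , inj₁ ()))
  corner-neighbours {_ , Fin.suc (Fin.suc _)} (inj₁ (refl , inj₁ ()))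
  corner-neighbours {Fin.zero , _}          (inj₂ (inj₁ () , refl))
  corner-neighbours {Fin.suc (Fin.suc _) , _} (inj₂ (inj₁ () , refl))
  corner-neighbours (inj₁ (refl , inj₂ ()))
  corner-neighbours (inj₂ (inj₂ () , refl))

  corner-enclosed : ∀ {Y : V G → Set} → Y p → Y q → ∀ c → Adj G corner c → Y c
  corner-enclosed Yp Yq c e with corner-neighbours e
  ... | inj₁ refl = Yp
  ... | inj₂ refl = Yq

  closed-neighbourhood : ∀ {v} → v ≡ corner ⊎ Adj G corner v → v ∈ corner-triangle
  closed-neighbourhood (inj₁ refl) = here refl
  closed-neighbourhood (inj₂ e) with corner-neighbours e
  ... | inj₁ refl = there (here refl)
  ... | inj₂ refl = there (there (here refl))

  corner-triangle-maximal : IsMaximalMV G (ListSet G corner-triangle)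
  corner-triangle-maximal = all-visible , maximal
    where
    all-visible : IsMutualVisibility G (ListSet G corner-triangle)
    all-visible = triangle-isMutualVisibility
      (inj₂ ((λ ()) , (λ ()))) (inj₁ ((λ ()) , (λ ()))) (inj₁ ((λ ()) , (λ ())))

    maximal : (Y : V G → Set) → (∀ v → ListSet G corner-triangle v → Y v) → IsMutualVisibility G Y →
              ∀ v → Y v → ListSet G corner-triangle v
    maximal Y ⊇triangle all-visible-Y v Yv =
      closed-neighbourhood (enclosed-sees-neighbours
        (corner-enclosed (⊇triangle p (there (here refl))) (⊇triangle q (there (there (here refl)))))
        (all-visible-Y corner v (⊇triangle corner (here refl)) Yv))

  another : (a : V G) → Σ (V G) (_≢ a)
  another (a₁ , a₂) = (punchIn a₁ Fin.zero , a₂) , punchInᵢ≢i a₁ Fin.zero ∘ cong proj₁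

  -- When a₁ ≢ b₁, c is put in b's column off b's row: a reaches b and c by L-walks that
  -- start along a's column, and b, c are joined inside column b₁.
  completes-triangle : ∀ {a b} → a ≢ b →
                       Σ (V G) λ c → c ∉ a ∷ b ∷ [] × IsMutualVisibility G (ListSet G (a ∷ b ∷ c ∷ []))
  completes-triangle {a₁ , a₂} {b₁ , b₂} a≢b with a₁ ≟ b₁
  ... | no a₁≢b₁ = (b₁ , t) , fresh , triangle-isMutualVisibility
                     (inj₂ (a₁≢b₁ ∘ sym , t≢b₂)) (inj₂ (a₁≢b₁ ∘ sym , t≢b₂ ∘ sym)) bc
    where
    t = punchIn b₂ Fin.zero
    t≢b₂ = punchInᵢ≢i b₂ Fin.zero
    fresh : (b₁ , t) ∉ (a₁ , a₂) ∷ (b₁ , b₂) ∷ []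
    fresh (here e)         = a₁≢b₁ (sym (cong proj₁ e))
    fresh (there (here e)) = t≢b₂ (cong proj₂ e)
    bc : Avoids (b₁ , b₂) (b₁ , t) (a₁ , a₂)
    bc with a₂ ≟ b₂
    ... | yes refl  = inj₂ (a₁≢b₁ , t≢b₂ ∘ sym)
    ... | no a₂≢b₂ = inj₁ (a₁≢b₁ , a₂≢b₂)
  ... | yes refl = (s , b₂) , fresh , triangle-isMutualVisibility
                     (inj₁ (s≢a₁ , a₂≢b₂ ∘ sym)) (inj₁ (s≢a₁ ∘ sym , a₂≢b₂ ∘ sym)) (inj₁ (s≢a₁ ∘ sym , a₂≢b₂))
    where
    s = punchIn a₁ Fin.zero
    s≢a₁ = punchInᵢ≢i a₁ Fin.zero
    a₂≢b₂ : a₂ ≢ b₂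
    a₂≢b₂ = a≢b ∘ cong (a₁ ,_)
    fresh : (s , b₂) ∉ (a₁ , a₂) ∷ (a₁ , b₂) ∷ []
    fresh (here e)         = s≢a₁ (cong proj₁ e)
    fresh (there (here e)) = s≢a₁ (cong proj₁ e)

  ¬maximal-within-pair : ∀ {a b xs} → a ≢ b → (∀ {v} → v ∈ xs → v ∈ a ∷ b ∷ []) →
                         ¬ IsMaximalMV G (ListSet G xs)
  ¬maximal-within-pair a≢b ⊆pair (_ , maximal) with completes-triangle a≢b
  ... | c , c∉pair , all-visible =
    c∉pair (⊆pair (maximal _ (λ _ → ∈-++⁺ˡ ∘ ⊆pair) all-visible c (there (there (here refl)))))

  maximal⇒3≤length : ∀ xs → Unique xs → IsMaximalMV G (ListSet G xs) → 3 ≤ length xs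
  maximal⇒3≤length [] _ mx = ⊥-elim (¬maximal-within-pair (proj₂ (another corner) ∘ sym) (λ ()) mx)
  maximal⇒3≤length (a ∷ []) _ mx = ⊥-elim (¬maximal-within-pair (proj₂ (another a) ∘ sym) ∈-++⁺ˡ mx)
  maximal⇒3≤length (a ∷ b ∷ []) ((a≢b ∷ []) ∷ _) mx = ⊥-elim (¬maximal-within-pair a≢b id mx)
  maximal⇒3≤length (_ ∷ _ ∷ _ ∷ _) _ _ = s≤s (s≤s (s≤s z≤n))

corollary2p4 : (m n : ℕ) → m ≥ 2 → n ≥ 2 → μ⁻≡ (P m □ P n) 3
corollary2p4 (suc (suc m)) (suc (suc n)) (s≤s (s≤s _)) (s≤s (s≤s _)) =
  (corner-triangle , unique , refl , corner-triangle-maximal) , maximal⇒3≤length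
  where
  open NontrivialGrid m n
  unique : Unique corner-triangle
  unique = ((λ ()) ∷ (λ ()) ∷ []) ∷ ((λ ()) ∷ []) ∷ [] ∷ []
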